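{- Let $g\ge4$ be even and let $m>g-1$ be an odd integer relatively prime to $g$. Let $G_{m,g}$ be the subgroup of $U(\mathbb{Z}_m)$ generated by $g$. If $C$ is a coset of $G_{m,g}$ in $U(\mathbb{Z}_m)$ such that every element of $C$, represented by its least nonnegative residue in $\{0,1,\dots,m-1\}$, is less than $\frac{2m}{g}$, then (the set of these representatives of) $C$ is an extreme cycle for the digit set $\{0,m\}$.
   Context: An extreme cycle for the digit set $\{0,m\}$ (with respect to the even integer $g\ge4$, $m$ odd) is a finite set of distinct integers $\{x_0,\dots,x_{r-1}\}$ together with digits $l_0,\dots,l_{r-1}\in\{0,m\}$ such that $x_{j+1}=(x_j+l_j)/g$ for $0\le j\le r-2$ and $x_0=(x_{r-1}+l_{r-1})/g$. -}

module Defs where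

open import Data.Nat as ℕ using (ℕ; _<_; _^_; _%_; NonZero)
open import Data.Integer as ℤ using (ℤ; +_)
open import Data.Product using (Σ; ∃; _×_; _,_)
open import Data.Sum using (_⊎_)
open import Relation.Binary.PropositionalEquality using (_≡_)
open import Function.Bundles using (_⇔_)

-- The coset a·G_{m,g} of the subgroup G_{m,g} = ⟨g⟩ of U(ℤ_m), where the
-- unit a is given by a natural number coprime to m (the coprimality is a
-- hypothesis of the theorem).
cosetRep : (m : ℕ) → .{{NonZero m}} → (g a : ℕ) → ℕ → ℕ
cosetRep m g a k = (a ℕ.* g ^ k) % m

CosetSet : (m : ℕ) → .{{NonZero m}} → (g a : ℕ) → ℤ → Set
CosetSet m g a y = ∃ λ k → y ≡ + cosetRep m g a k

-- Extreme cycle for the digit set {0,m} w.r.t. g: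
-- a listing x₀,…,x_{r-1} (r ≥ 1) of distinct integers and digits
-- l₀,…,l_{r-1} ∈ {0,m} with  g·x_{j+1} = x_j + l_j  for 0 ≤ j ≤ r-2 and
-- g·x₀ = x_{r-1} + l_{r-1}  (encoded as x_r ≡ x₀ with the recurrence for j < r).
record IsExtremeCycle (g m : ℕ) (r : ℕ) (x l : ℕ → ℤ) : Set where
  field
    r-pos    : 0 < r
    distinct : ∀ i j → i < r → j < r → x i ≡ x j → i ≡ j
    digits   : ∀ j → j < r → l j ≡ + 0 ⊎ l j ≡ + m
    step     : ∀ j → j < r → (+ g) ℤ.* x (ℕ.suc j) ≡ x j ℤ.+ l j
    closes   : x r ≡ x 0

ExtremeCycle : (g m : ℕ) → (ℤ → Set) → Set
ExtremeCycle g m S =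
  Σ ℕ λ r → Σ (ℕ → ℤ) λ x → Σ (ℕ → ℤ) λ l →
    IsExtremeCycle g m r x l × (∀ y → S y ⇔ (∃ λ j → j < r × x j ≡ y))

module Submission where

-- The coset is the orbit of a under multiplication by g modulo m.  If r is the
-- order of g, the residues cᵢ = (a gⁱ) mod m, i < r, are distinct and cᵣ = c₀.
-- Since g cᵢ ≡ cᵢ₊₁ (mod m), we have g cᵢ = cᵢ₊₁ + qᵢ m with qᵢ = ⌊g cᵢ / m⌋,
-- and the hypothesis g cᵢ < 2m forces qᵢ ∈ {0, 1}.  Read backwards,
-- x_j = c_{r-j} is therefore an extreme cycle with digits l_j = q_{r-j-1} m.

open import Defs
open import Data.Nat using (ℕ; zero; suc; _+_; _∸_; _*_; _^_; _%_; _/_; _≤_; _<_; z≤n; s≤s; _≟_; NonZero)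
open import Data.Nat.Properties
open import Data.Nat.DivMod
open import Data.Nat.Divisibility using (_∣_; divides)
open import Data.Nat.Coprimality using (Coprime)
import Data.Nat.Coprimality as Coprime
open import Algebra.Properties.CommutativeSemigroup *-commutativeSemigroup using (x∙yz≈y∙xz)
open import Data.Integer as ℤ using (ℤ; +_)
import Data.Integer.Properties as ℤ
open import Data.Fin using (toℕ; fromℕ<)
import Data.Fin.Properties as Fin
open import Data.Product using (∃; _×_; _,_; proj₁; proj₂)
open import Data.Sum using (_⊎_; inj₁; inj₂)
open import Relation.Nullary using (¬_; yes; no; contradiction)
open import Relation.Unary using (Pred; Decidable)
open import Relation.Binary using (tri<; tri≈; tri>)
open import Relation.Binary.PropositionalEquality
open import Function.Bundles using (mk⇔)

Least : ∀ {p} → Pred ℕ p → Set p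
Least P = ∃ λ k → P k × (∀ j → j < k → ¬ P j)

module _ {p} {P : Pred ℕ p} (P? : Decidable P) where

  private
    none-below-or-least : ∀ n → (∀ j → j < n → ¬ P j) ⊎ Least P
    none-below-or-least zero = inj₁ λ _ ()
    none-below-or-least (suc n) with none-below-or-least n
    ... | inj₂ least = inj₂ least
    ... | inj₁ none with P? n
    ...   | yes pn = inj₂ (n , pn , none)
    ...   | no ¬pn = inj₁ none-below-suc
      where
      none-below-suc : ∀ j → j < suc n → ¬ P j
      none-below-suc j j<1+n with m<1+n⇒m<n∨m≡n j<1+n
      ... | inj₁ j<n  = none j j<n
      ... | inj₂ refl = ¬pn

  least-witness : ∀ {n} → P n → Least P
  least-witness {n} pn with none-below-or-least (suc n)
  ... | inj₁ none  = contradiction pn (none n ≤-refl)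
  ... | inj₂ least = least

module Residues {m : ℕ} .{{_ : NonZero m}} where

  %-≡⇒∣∸ : ∀ {x y} → x % m ≡ y % m → m ∣ x ∸ y
  %-≡⇒∣∸ {x} {y} x≡y = divides (x / m ∸ y / m) (begin
    x ∸ y                                     ≡⟨ cong₂ _∸_ (m≡m%n+[m/n]*n x m) (m≡m%n+[m/n]*n y m) ⟩
    (x % m + x / m * m) ∸ (y % m + y / m * m) ≡⟨ cong (λ z → (z + x / m * m) ∸ (y % m + y / m * m)) x≡y ⟩
    (y % m + x / m * m) ∸ (y % m + y / m * m) ≡⟨ [m+n]∸[m+o]≡n∸o (y % m) _ _ ⟩
    x / m * m ∸ y / m * m                     ≡⟨ *-distribʳ-∸ m (x / m) (y / m) ⟨
    (x / m ∸ y / m) * m                       ∎)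
    where open ≡-Reasoning

  %-cong-*ˡ : ∀ c {x y} → x % m ≡ y % m → (c * x) % m ≡ (c * y) % m
  %-cong-*ˡ c {x} {y} x≡y = begin
    (c * x) % m             ≡⟨ %-distribˡ-* c x m ⟩
    (c % m * (x % m)) % m   ≡⟨ cong (λ z → (c % m * z) % m) x≡y ⟩
    (c % m * (y % m)) % m   ≡⟨ %-distribˡ-* c y m ⟨
    (c * y) % m             ∎
    where open ≡-Reasoning

  private
    %-cancel-*ˡ-≤ : ∀ {c x y} → Coprime m c → x ≤ y →
                    (c * x) % m ≡ (c * y) % m → x % m ≡ y % m
    %-cancel-*ˡ-≤ {c} {x} {y} m⊥c x≤y cx≡cy = begin
      x % m             ≡⟨ %-remove-+ʳ x m∣y∸x ⟨
      (x + (y ∸ x)) % m ≡⟨ cong (_% m) (m+[n∸m]≡n x≤y) ⟩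
      y % m             ∎
      where
      open ≡-Reasoning
      m∣c[y∸x] : m ∣ c * (y ∸ x)
      m∣c[y∸x] = subst (m ∣_) (sym (*-distribˡ-∸ c y x))
                   (%-≡⇒∣∸ (sym cx≡cy))
      m∣y∸x : m ∣ y ∸ x
      m∣y∸x = Coprime.coprime-divisor m⊥c m∣c[y∸x]

  %-cancel-*ˡ : ∀ {c x y} → Coprime m c → (c * x) % m ≡ (c * y) % m → x % m ≡ y % m
  %-cancel-*ˡ {c} {x} {y} m⊥c cx≡cy with ≤-total x y
  ... | inj₁ x≤y = %-cancel-*ˡ-≤ m⊥c x≤y cx≡cy
  ... | inj₂ y≤x = sym (%-cancel-*ˡ-≤ m⊥c y≤x (sym cx≡cy))

  %-cancel-^ˡ : ∀ {g} u {x y} → Coprime m g →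
                (g ^ u * x) % m ≡ (g ^ u * y) % m → x % m ≡ y % m
  %-cancel-^ˡ         zero    {x} {y} _   gx≡gy =
    subst₂ (λ p q → p % m ≡ q % m) (+-identityʳ x) (+-identityʳ y) gx≡gy
  %-cancel-^ˡ {g} (suc u) {x} {y} m⊥g gx≡gy = %-cancel-^ˡ u m⊥g (%-cancel-*ˡ m⊥g
    (subst₂ (λ p q → p % m ≡ q % m) (*-assoc g (g ^ u) x) (*-assoc g (g ^ u) y) gx≡gy))

module MultiplicativeOrder {m : ℕ} .{{_ : NonZero m}} {g : ℕ} (m⊥g : Coprime m g) where

  open Residues

  ^-%-shift-cancel : ∀ u d → g ^ (u + d) % m ≡ g ^ u % m → g ^ d % m ≡ 1 % m
  ^-%-shift-cancel u d gᵘ⁺ᵈ≡gᵘ = %-cancel-^ˡ u m⊥g (begin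
    (g ^ u * g ^ d) % m ≡⟨ cong (_% m) (^-distribˡ-+-* g u d) ⟨
    g ^ (u + d) % m     ≡⟨ gᵘ⁺ᵈ≡gᵘ ⟩
    g ^ u % m           ≡⟨ cong (_% m) (*-identityʳ (g ^ u)) ⟨
    (g ^ u * 1) % m     ∎)
    where open ≡-Reasoning

  -- Among g⁰, …, gᵐ two residues agree (pigeonhole), and g can be cancelled.
  ∃-^-%≡1 : ∃ λ d → g ^ suc d % m ≡ 1 % m
  ∃-^-%≡1 with Fin.pigeonhole (n<1+n m) (λ i → fromℕ< (m%n<n (g ^ toℕ i) m))
  ... | i , j , i<j , residueᵢ≡residueⱼ with m≤n⇒∃[o]m+o≡n i<j
  ...   | d , 1+i+d≡j = d , ^-%-shift-cancel (toℕ i) (suc d) (begin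
    g ^ (toℕ i + suc d) % m ≡⟨ cong (λ e → g ^ e % m) (trans (+-suc (toℕ i) d) 1+i+d≡j) ⟩
    g ^ toℕ j % m           ≡⟨ Fin.toℕ-fromℕ< _ ⟨
    toℕ (fromℕ< _)          ≡⟨ cong toℕ residueᵢ≡residueⱼ ⟨
    toℕ (fromℕ< _)          ≡⟨ Fin.toℕ-fromℕ< _ ⟩
    g ^ toℕ i % m           ∎)
    where open ≡-Reasoning

  -- Kept opaque: unfolding the search makes Agda normalise powers of g.
  opaque
    least-exponent : Least λ d → g ^ suc d % m ≡ 1 % m
    least-exponent = least-witness (λ d → g ^ suc d % m ≟ 1 % m) {proj₁ ∃-^-%≡1} (proj₂ ∃-^-%≡1)

  order : ℕ
  order = suc (proj₁ least-exponent)

  ^order-%≡1 : g ^ order % m ≡ 1 % m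
  ^order-%≡1 = proj₁ (proj₂ least-exponent)

  ^-%-periodic : ∀ k → g ^ k % m ≡ g ^ (k % order) % m
  ^-%-periodic k = begin
    g ^ k % m                                          ≡⟨ cong (λ e → g ^ e % m) (m≡m%n+[m/n]*n k order) ⟩
    g ^ (k % order + k / order * order) % m            ≡⟨ cong (_% m) (^-distribˡ-+-* g (k % order) _) ⟩
    (g ^ (k % order) * g ^ (k / order * order)) % m    ≡⟨ %-cong-*ˡ (g ^ (k % order)) (^multiple-%≡1 (k / order)) ⟩
    (g ^ (k % order) * 1) % m                          ≡⟨ cong (_% m) (*-identityʳ _) ⟩
    g ^ (k % order) % m                                ∎
    where
    open ≡-Reasoning
    ^multiple-%≡1 : ∀ q → g ^ (q * order) % m ≡ 1 % m
    ^multiple-%≡1 zero    = refl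
    ^multiple-%≡1 (suc q) = begin
      g ^ (order + q * order) % m         ≡⟨ cong (_% m) (^-distribˡ-+-* g order (q * order)) ⟩
      (g ^ order * g ^ (q * order)) % m   ≡⟨ %-cong-*ˡ (g ^ order) (^multiple-%≡1 q) ⟩
      (g ^ order * 1) % m                 ≡⟨ cong (_% m) (*-identityʳ (g ^ order)) ⟩
      g ^ order % m                       ≡⟨ ^order-%≡1 ⟩
      1 % m                               ∎

  ^-%-distinct : ∀ u {d} → 0 < d → d < order → g ^ (u + d) % m ≢ g ^ u % m
  ^-%-distinct u {suc d} _ (s≤s d<pred-order) gᵘ⁺ᵈ≡gᵘ =
    proj₂ (proj₂ least-exponent) d d<pred-order (^-%-shift-cancel u (suc d) gᵘ⁺ᵈ≡gᵘ)

module Coset {m : ℕ} .{{_ : NonZero m}} {g : ℕ} (m⊥g : Coprime m g) (a : ℕ) (a⊥m : Coprime a m) where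

  open Residues
  open MultiplicativeOrder m⊥g

  c : ℕ → ℕ
  c = cosetRep m g a

  g*c≡c-suc+quotient : ∀ k → g * c k ≡ c (suc k) + (g * c k) / m * m
  g*c≡c-suc+quotient k = begin
    g * c k                            ≡⟨ m≡m%n+[m/n]*n (g * c k) m ⟩
    (g * c k) % m + (g * c k) / m * m  ≡⟨ cong (_+ (g * c k) / m * m) g*c≡c-suc ⟩
    c (suc k) + (g * c k) / m * m      ∎
    where
    open ≡-Reasoning
    g*c≡c-suc : (g * c k) % m ≡ c (suc k)
    g*c≡c-suc = begin
      (g * ((a * g ^ k) % m)) % m   ≡⟨ %-cong-*ˡ g (m%n%n≡m%n (a * g ^ k) m) ⟩
      (g * (a * g ^ k)) % m         ≡⟨ cong (_% m) (x∙yz≈y∙xz g a (g ^ k)) ⟩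
      (a * (g * g ^ k)) % m         ∎

  c-cong : ∀ i j → g ^ i % m ≡ g ^ j % m → c i ≡ c j
  c-cong _ _ = %-cong-*ˡ a

  c-periodic : ∀ k → c k ≡ c (k % order)
  c-periodic k = c-cong k (k % order) (^-%-periodic k)

  c-order : c order ≡ c 0
  c-order = c-cong order 0 ^order-%≡1

  c-distinct : ∀ u {d} → 0 < d → d < order → c (u + d) ≢ c u
  c-distinct u 0<d d<order cᵘ⁺ᵈ≡cᵘ =
    ^-%-distinct u 0<d d<order (%-cancel-*ˡ (Coprime.sym a⊥m) cᵘ⁺ᵈ≡cᵘ)

m<2n⇒m/n*n≡0∨n : ∀ {x n} .{{_ : NonZero n}} → x < 2 * n → x / n * n ≡ 0 ⊎ x / n * n ≡ n
m<2n⇒m/n*n≡0∨n {x} {n} x<2n with x / n | m<n*o⇒m/o<n {x} {2} {n} x<2n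
... | 0 | _ = inj₁ refl
... | 1 | _ = inj₂ (+-identityʳ n)
... | suc (suc _) | s≤s (s≤s ())

m∸o≡m∸n+[n∸o] : ∀ {m n o} → o ≤ n → n ≤ m → m ∸ o ≡ m ∸ n + (n ∸ o)
m∸o≡m∸n+[n∸o] {m} {n} {o} o≤n n≤m =
  trans (cong (_∸ o) (sym (m∸n+n≡m n≤m))) (+-∸-assoc (m ∸ n) o≤n)

module ReversedCoset {m : ℕ} .{{_ : NonZero m}} {g : ℕ} (m⊥g : Coprime m g) (a : ℕ) (a⊥m : Coprime a m)
                     (g*c<2m : ∀ k → g * cosetRep m g a k < 2 * m) where

  open MultiplicativeOrder m⊥g
  open Coset m⊥g a a⊥m

  x : ℕ → ℤ
  x j = + c (order ∸ j)

  l : ℕ → ℤ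
  l j = + ((g * c (order ∸ suc j)) / m * m)

  step : ∀ j → j < order → + g ℤ.* x (suc j) ≡ x j ℤ.+ l j
  step j j<order = begin
    + g ℤ.* + c k                            ≡⟨ ℤ.pos-* g (c k) ⟨
    + (g * c k)                              ≡⟨ cong +_ (g*c≡c-suc+quotient k) ⟩
    + (c (suc k) + (g * c k) / m * m)        ≡⟨ ℤ.pos-+ (c (suc k)) _ ⟩
    + c (suc k) ℤ.+ l j                      ≡⟨ cong (λ e → + c e ℤ.+ l j) (+-∸-assoc 1 j<order) ⟨
    x j ℤ.+ l j                              ∎
    where
    open ≡-Reasoning
    k = order ∸ suc j

  digits : ∀ j → j < order → l j ≡ + 0 ⊎ l j ≡ + m
  digits j _ with m<2n⇒m/n*n≡0∨n (g*c<2m (order ∸ suc j))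
  ... | inj₁ q≡0 = inj₁ (cong +_ q≡0)
  ... | inj₂ q≡m = inj₂ (cong +_ q≡m)

  closes : x order ≡ x 0
  closes = cong +_ (trans (cong c (n∸n≡0 order)) (sym c-order))

  x-distinct : ∀ {i j} → i < j → j < order → x i ≢ x j
  x-distinct {i} {j} i<j j<order xᵢ≡xⱼ =
    subst (λ e → c e ≢ c (order ∸ j)) (sym (m∸o≡m∸n+[n∸o] (<⇒≤ i<j) (<⇒≤ j<order)))
      (c-distinct (order ∸ j) (m<n⇒0<n∸m i<j) (≤-<-trans (m∸n≤m j i) j<order))
      (ℤ.+-injective xᵢ≡xⱼ)

  distinct : ∀ i j → i < order → j < order → x i ≡ x j → i ≡ j
  distinct i j i<order j<order xᵢ≡xⱼ with <-cmp i j
  ... | tri< i<j _ _ = contradiction xᵢ≡xⱼ (x-distinct i<j j<order)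
  ... | tri≈ _ i≡j _ = i≡j
  ... | tri> _ _ j<i = contradiction (sym xᵢ≡xⱼ) (x-distinct j<i i<order)

  covers : ∀ k → ∃ λ j → j < order × x j ≡ + c k
  covers k with k % order | m%n<n k order | c-periodic k
  ... | zero  | _       | cₖ≡c₀ = 0 , s≤s z≤n , cong +_ (trans c-order (sym cₖ≡c₀))
  ... | suc s | s<order | cₖ≡cₛ =
    order ∸ suc s , ∸-monoʳ-< (s≤s z≤n) (<⇒≤ s<order) ,
    cong +_ (trans (cong c (m∸[m∸n]≡n (<⇒≤ s<order))) (sym cₖ≡cₛ))

  isExtremeCycle : IsExtremeCycle g m order x l
  isExtremeCycle = record
    { r-pos = s≤s z≤n ; distinct = distinct ; digits = digits ; step = step ; closes = closes }

proposition2p14 : (g m : ℕ) → .{{_ : NonZero m}} → 4 ≤ g → 2 ∣ g → ¬ (2 ∣ m) →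
    g ≤ m → Coprime m g →
    (a : ℕ) → Coprime a m →
    (∀ k → g * cosetRep m g a k < 2 * m) →
    ExtremeCycle g m (CosetSet m g a)
proposition2p14 g m _ _ _ _ m⊥g a a⊥m g*c<2m =
  order , x , l , isExtremeCycle , λ y → mk⇔ (cover y) (λ (j , _ , xⱼ≡y) → order ∸ j , sym xⱼ≡y)
  where
  open MultiplicativeOrder m⊥g using (order)
  open ReversedCoset m⊥g a a⊥m g*c<2m
  cover : ∀ y → CosetSet m g a y → ∃ λ j → j < order × x j ≡ y
  cover y (k , refl) = covers k
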